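{- For any bipartite graph $G$ of order $n$, $$\gamma_{\rm sp}(G)\ge n-\beta(G).$$
   Context: All graphs are finite, simple and undirected. For a vertex $v$ of a graph $G$, $N(v)$ denotes the set of vertices adjacent to $v$. For $D\subseteq V(G)$ write $\overline{D}=V(G)\setminus D$. A set $D\subseteq V(G)$ is a super dominating set of $G$ if for every $u\in\overline{D}$ there exists $v\in D$ such that $N(v)\cap\overline{D}=\{u\}$. The super domination number $\gamma_{\rm sp}(G)$ is the minimum cardinality of a super dominating set of $G$. A vertex cover of $G$ is a set $X\subseteq V(G)$ such that every edge of $G$ has at least one endpoint in $X$; the vertex cover number $\beta(G)$ is the minimum cardinality of a vertex cover of $G$. -}

module Defs where

open import Data.Nat using (ℕ; _≤_)
open import Data.Fin using (Fin)
open import Data.Bool using (Bool; true; false)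
open import Data.Fin.Subset using (Subset; _∈_; _∉_; ∣_∣)
open import Data.Product using (Σ; ∃; _×_; _,_)
open import Data.Sum using (_⊎_)
open import Relation.Binary.PropositionalEquality using (_≡_; _≢_)
open import Relation.Nullary using (¬_)

record Graph (n : ℕ) : Set₁ where
  field
    Adj   : Fin n → Fin n → Set
    sym   : ∀ {u v} → Adj u v → Adj v u
    irrefl : ∀ {v} → ¬ Adj v v

open Graph public

Bipartite : ∀ {n} → Graph n → Set
Bipartite {n} G = Σ (Fin n → Bool) λ c → ∀ {u v} → Adj G u v → c u ≢ c v

PrivateExtNbr : ∀ {n} → Graph n → Subset n → Fin n → Fin n → Set
PrivateExtNbr G D v u =
  (Adj G v u × u ∉ D) × (∀ w → Adj G v w → w ∉ D → w ≡ u)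

IsSuperDominating : ∀ {n} → Graph n → Subset n → Set
IsSuperDominating {n} G D =
  ∀ u → u ∉ D → Σ (Fin n) λ v → v ∈ D × PrivateExtNbr G D v u

IsVertexCover : ∀ {n} → Graph n → Subset n → Set
IsVertexCover G X = ∀ {u v} → Adj G u v → u ∈ X ⊎ v ∈ X

IsMinimum : ∀ {n} → (Subset n → Set) → ℕ → Set
IsMinimum P k = (Σ _ λ S → P S × ∣ S ∣ ≡ k) × (∀ S → P S → k ≤ ∣ S ∣)

IsSuperDominationNumber : ∀ {n} → Graph n → ℕ → Set
IsSuperDominationNumber G = IsMinimum (IsSuperDominating G)

IsVertexCoverNumber : ∀ {n} → Graph n → ℕ → Set
IsVertexCoverNumber G = IsMinimum (IsVertexCover G)

-- Send each vertex u outside a super dominating set D to u itself if u lies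
-- in the vertex cover X, and otherwise to its private neighbour in D; the
-- latter is in X because the edge to u must be covered. The map is injective
-- (distinct vertices outside D have distinct private neighbours, and D is
-- disjoint from its complement), so n − ∣ D ∣ ≤ ∣ X ∣.
module Submission where

open import Defs hiding (sym)
open import Data.Nat using (ℕ; _≤_; _+_; _∸_)
open import Data.Nat.Properties using (m≤n+m∸n; +-monoʳ-≤; +-comm; m≤n+o⇒m∸n≤o; module ≤-Reasoning)
open import Data.Fin using (Fin; zero; suc)
open import Data.Fin.Properties using (injective⇒≤; suc-injective)
open import Data.Fin.Subset using (Subset; _∈_; ∣_∣; ∁; inside; outside)
open import Data.Fin.Subset.Properties using (_∈?_; x∈∁p⇒x∉p; ∣∁p∣≡n∸∣p∣)
open import Data.Vec using (_∷_; here; there)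
open import Data.Product using (_,_; proj₁; proj₂)
open import Data.Sum using (inj₁; inj₂)
open import Relation.Nullary using (yes; no; contradiction)
open import Relation.Binary.PropositionalEquality
  using (_≡_; refl; cong; subst; sym; module ≡-Reasoning)

m∸n≤o⇒m∸o≤n : ∀ m n o → m ∸ n ≤ o → m ∸ o ≤ n
m∸n≤o⇒m∸o≤n m n o m∸n≤o = m≤n+o⇒m∸n≤o m o (begin
  m           ≤⟨ m≤n+m∸n m n ⟩
  n + (m ∸ n) ≤⟨ +-monoʳ-≤ n m∸n≤o ⟩
  n + o       ≡⟨ +-comm n o ⟩
  o + n       ∎)
  where open ≤-Reasoning

private variable n : ℕ

element : (p : Subset n) → Fin ∣ p ∣ → Fin n
element (inside  ∷ p) zero    = zero
element (inside  ∷ p) (suc i) = suc (element p i)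
element (outside ∷ p) i       = suc (element p i)

element∈ : (p : Subset n) (i : Fin ∣ p ∣) → element p i ∈ p
element∈ (inside  ∷ p) zero    = here
element∈ (inside  ∷ p) (suc i) = there (element∈ p i)
element∈ (outside ∷ p) i       = there (element∈ p i)

element-injective : (p : Subset n) {i j : Fin ∣ p ∣} → element p i ≡ element p j → i ≡ j
element-injective (inside  ∷ p) {zero}  {zero}  _  = refl
element-injective (inside  ∷ p) {suc i} {suc j} eq = cong suc (element-injective p (suc-injective eq))
element-injective (outside ∷ p)                 eq = element-injective p (suc-injective eq)

index : (p : Subset n) {x : Fin n} → x ∈ p → Fin ∣ p ∣
index (inside  ∷ p) here        = zero
index (inside  ∷ p) (there x∈p) = suc (index p x∈p)
index (outside ∷ p) (there x∈p) = index p x∈p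

element-index : (p : Subset n) {x : Fin n} (x∈p : x ∈ p) → element p (index p x∈p) ≡ x
element-index (inside  ∷ p) here        = refl
element-index (inside  ∷ p) (there x∈p) = cong suc (element-index p x∈p)
element-index (outside ∷ p) (there x∈p) = cong suc (element-index p x∈p)

∣p∣≤∣q∣-by-injection : (p q : Subset n) (f : ∀ {x} → x ∈ p → Fin n) →
  (∀ {x} (x∈p : x ∈ p) → f x∈p ∈ q) →
  (∀ {x y} (x∈p : x ∈ p) (y∈p : y ∈ p) → f x∈p ≡ f y∈p → x ≡ y) →
  ∣ p ∣ ≤ ∣ q ∣
∣p∣≤∣q∣-by-injection p q f f∈q f-injective = injective⇒≤ {f = g} g-injective
  where
  g : Fin ∣ p ∣ → Fin ∣ q ∣
  g i = index q (f∈q (element∈ p i))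

  g-injective : ∀ {i j} → g i ≡ g j → i ≡ j
  g-injective {i} {j} gi≡gj = element-injective p (f-injective _ _ (begin
    f (element∈ p i) ≡⟨ sym (element-index q _) ⟩
    element q (g i)  ≡⟨ cong (element q) gi≡gj ⟩
    element q (g j)  ≡⟨ element-index q _ ⟩
    f (element∈ p j) ∎))
    where open ≡-Reasoning

module _ (G : Graph n) {D : Subset n} (D-sd : IsSuperDominating G D) where

  privateNeighbour : ∀ {u} → u ∈ ∁ D → Fin n
  privateNeighbour {u} u∈∁D = proj₁ (D-sd u (x∈∁p⇒x∉p u∈∁D))

  privateNeighbour∈D : ∀ {u} (u∈∁D : u ∈ ∁ D) → privateNeighbour u∈∁D ∈ D
  privateNeighbour∈D {u} u∈∁D = proj₁ (proj₂ (D-sd u (x∈∁p⇒x∉p u∈∁D)))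

  privateNeighbour-adjacent : ∀ {u} (u∈∁D : u ∈ ∁ D) → Adj G (privateNeighbour u∈∁D) u
  privateNeighbour-adjacent {u} u∈∁D = proj₁ (proj₁ (proj₂ (proj₂ (D-sd u (x∈∁p⇒x∉p u∈∁D)))))

  privateNeighbour-injective : ∀ {u u′} (u∈∁D : u ∈ ∁ D) (u′∈∁D : u′ ∈ ∁ D) →
    privateNeighbour u∈∁D ≡ privateNeighbour u′∈∁D → u ≡ u′
  privateNeighbour-injective {u} {u′} u∈∁D u′∈∁D v≡v′ =
    only-u′ u (subst (λ w → Adj G w u) v≡v′ (privateNeighbour-adjacent u∈∁D)) (x∈∁p⇒x∉p u∈∁D)
    where only-u′ = proj₂ (proj₂ (proj₂ (D-sd u′ (x∈∁p⇒x∉p u′∈∁D))))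

  ∣∁D∣≤∣X∣ : {X : Subset n} → IsVertexCover G X → ∣ ∁ D ∣ ≤ ∣ X ∣
  ∣∁D∣≤∣X∣ {X} X-vc = ∣p∣≤∣q∣-by-injection (∁ D) X representative representative∈X
                                          representative-injective
    where
    representative : ∀ {u} → u ∈ ∁ D → Fin n
    representative {u} u∈∁D with u ∈? X
    ... | yes _ = u
    ... | no  _ = privateNeighbour u∈∁D

    representative∈X : ∀ {u} (u∈∁D : u ∈ ∁ D) → representative u∈∁D ∈ X
    representative∈X {u} u∈∁D with u ∈? X
    ... | yes u∈X = u∈X
    ... | no  u∉X with X-vc (privateNeighbour-adjacent u∈∁D)
    ...   | inj₁ v∈X = v∈X
    ...   | inj₂ u∈X = contradiction u∈X u∉X

    representative-injective : ∀ {u u′} (u∈∁D : u ∈ ∁ D) (u′∈∁D : u′ ∈ ∁ D) →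
      representative u∈∁D ≡ representative u′∈∁D → u ≡ u′
    representative-injective {u} {u′} u∈∁D u′∈∁D eq with u ∈? X | u′ ∈? X
    ... | yes _ | yes _ = eq
    ... | yes _ | no  _ = contradiction (subst (_∈ D) (sym eq) (privateNeighbour∈D u′∈∁D)) (x∈∁p⇒x∉p u∈∁D)
    ... | no  _ | yes _ = contradiction (subst (_∈ D) eq (privateNeighbour∈D u∈∁D)) (x∈∁p⇒x∉p u′∈∁D)
    ... | no  _ | no  _ = privateNeighbour-injective u∈∁D u′∈∁D eq

theorem5 : (n : ℕ) (G : Graph n) → Bipartite G →
    (γsp β : ℕ) → IsSuperDominationNumber G γsp → IsVertexCoverNumber G β →
    n ∸ β ≤ γsp
theorem5 n G _ γsp β ((D , D-sd , refl) , _) ((X , X-vc , refl) , _) =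
  m∸n≤o⇒m∸o≤n n ∣ D ∣ ∣ X ∣
    (subst (_≤ ∣ X ∣) (∣∁p∣≡n∸∣p∣ D) (∣∁D∣≤∣X∣ G D-sd X-vc))
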